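{- Let $(W,S)$ be a finitely generated Coxeter system and let $A\subseteq T$ be nice. Let $I,J\in\mathcal{P}_{\mathrm{ad}}(A)$, $w\in W$ and $s\in S$ such that $w\smile_A sw$. Then $\psi_s^A(D_A(I,J,w))=D_A(I,J,sw)$.
   Context: $\ell$ is the length function, $T=\{wsw^{ -1}\mid w\in W,s\in S\}$, $D_A(w)=\{r\in A\mid\ell(wr)<\ell(w)\}$. $\mathcal{P}_{\mathrm{ad}}(A)$ is the set of $I\subseteq A$ with $I=D_A(w)$ for some $w$; $D_I^A=\{w\mid D_A(w)=I\}$; $D_A(I,J,w)=\{(u,v)\in D_I^A\times D_J^A\mid uv=w\}$. $A$ is nice if for every $r\in A$ and $w\in W$ with $w^{ -1}rw\notin A$, $D_A(rw)=D_A(w)$. Write $w\smile_A w'$ if $w'w^{ -1}\in S$ and $w^{ -1}w'\notin A$. For $s\in S$ define $\psi_s^A:W\times W\to W\times W$ by $\psi_s^A(u,v)=(su,v)$ if $u\smile_A su$, and $\psi_s^A(u,v)=(u,u^{ -1}suv)$ otherwise. -}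

module Defs where

open import Data.Nat using (ℕ; _<_)
open import Data.Fin using (Fin)
open import Data.List using (List; []; _∷_; _++_; length; reverse; concat; replicate)
open import Data.Product using (Σ; _×_; _,_)
open import Data.Sum using (_⊎_)
open import Relation.Nullary using (¬_)
open import Relation.Binary.PropositionalEquality using (_≡_; _≢_)
open import Function.Bundles using (_⇔_)

-- A Coxeter matrix on the finite generating set S = Fin n.
-- m i j = 0 encodes m(s,t) = ∞.
record CoxeterMatrix (n : ℕ) : Set where
  field
    m     : Fin n → Fin n → ℕ
    diag  : ∀ i → m i i ≡ 1
    symm  : ∀ i j → m i j ≡ m j i
    off   : ∀ i j → i ≢ j → m i j ≢ 1

module Coxeter {n : ℕ} (M : CoxeterMatrix n) where
  open CoxeterMatrix M

  Gen : Set
  Gen = Fin n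

  -- Elements of W are represented by words in S; equality in W is _~_.
  Word : Set
  Word = List Gen

  relator : Gen → Gen → ℕ → Word
  relator s t k = concat (replicate k (s ∷ t ∷ []))

  data _~_ : Word → Word → Set where
    rel   : ∀ u v s t → m s t ≢ 0 → (u ++ relator s t (m s t) ++ v) ~ (u ++ v)
    ~refl : ∀ {u} → u ~ u
    ~sym  : ∀ {u v} → u ~ v → v ~ u
    ~trans : ∀ {u v w} → u ~ v → v ~ w → u ~ w

  -- group operations (generators are involutions, so inverse = reversal)
  _·_ : Word → Word → Word
  u · v = u ++ v

  _⁻¹ : Word → Word
  u ⁻¹ = reverse u

  gen : Gen → Word
  gen s = s ∷ []

  -- ℓ(u) < ℓ(v), where ℓ is the Coxeter length (minimal word length)
  _ℓ<_ : Word → Word → Set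
  u ℓ< v = Σ Word λ u' → (u' ~ u) × (∀ v' → v' ~ v → length u' < length v')

  Subset : Set₁
  Subset = Word → Set

  RespectsW : Subset → Set
  RespectsW A = ∀ {u v} → u ~ v → A u → A v

  _≐_ : Subset → Subset → Set
  X ≐ Y = ∀ x → X x ⇔ Y x

  InT : Subset
  InT t = Σ Word λ w → Σ Gen λ s → t ~ (w · (gen s · (w ⁻¹)))

  InS : Subset
  InS x = Σ Gen λ s → x ~ gen s

  D : Subset → Word → Subset
  D A w r = A r × ((w · r) ℓ< w)

  Admissible : Subset → Subset → Set
  Admissible A I = Σ Word λ w → I ≐ D A w

  InDI : Subset → Subset → Word → Set
  InDI A I w = D A w ≐ I

  InDIJ : Subset → Subset → Subset → Word → Word → Word → Set
  InDIJ A I J w u v = InDI A I u × InDI A J v × ((u · v) ~ w)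

  Nice : Subset → Set
  Nice A = ∀ r w → A r → ¬ A ((w ⁻¹) · (r · w)) → D A (r · w) ≐ D A w

  Smile : Subset → Word → Word → Set
  Smile A w w' = InS (w' · (w ⁻¹)) × ¬ A ((w ⁻¹) · w')

  -- graph of ψ_s^A, up to equality in W × W:
  -- Psi A s (u , v) (u' , v')  iff  ψ_s^A(u,v) = (u',v') in W × W
  Psi : Subset → Gen → Word → Word → Word → Word → Set
  Psi A s u v u' v' =
      (Smile A u (gen s · u) × (u' ~ (gen s · u)) × (v' ~ v))
    ⊎ (¬ Smile A u (gen s · u) × (u' ~ u) × (v' ~ ((u ⁻¹) · (gen s · (u · v)))))

{-# OPTIONS --safe #-}
-- Tits' reflection cocycle: for words τ and w = s₁⋯sₖ let parity τ w be the parity of the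
-- number of crossings of τ in w, i.e. of the i with τ = s₁⋯sᵢ₋₁sᵢsᵢ₋₁⋯s₁ in W. It is invariant
-- under the Coxeter relations, and for a reflection r one has ℓ(wr) < ℓ(w) iff parity r w⁻¹ is
-- odd: deleting the letter at a crossing of a reduced word gives one direction, and the oddness
-- of parity r r⁻¹ the other. The crossings of s·u and of u differ only by u⁻¹su, so left
-- multiplication by s preserves D_A(u) when u⁻¹su ∉ A; this handles the first branch of ψ_s^A.
-- In the second branch u⁻¹su ∈ A, and niceness applies to it and v because its conjugate by v
-- is w⁻¹sw ∉ A. Conversely, (p, q) ∈ D_A(I,J,sw) is the image of (sp, q) or of (p, p⁻¹spq)
-- according as p⁻¹sp ∉ A or p⁻¹sp ∈ A.
module Submission where

open import Defs
open import Axiom.ExcludedMiddle using (ExcludedMiddle)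
open import Data.Bool using (Bool; true; false; _xor_)
open import Data.Bool.Properties using (xor-assoc; xor-same; xor-comm; xor-identityʳ)
open import Data.Empty using (⊥; ⊥-elim)
open import Data.List using ([]; _∷_; _++_; reverse; [_]; length)
open import Data.List.Properties using (++-assoc; ++-identityʳ; reverse-++; reverse-involutive; unfold-reverse; length-++-sucʳ)
open import Data.Nat using (ℕ; zero; suc; _+_; _≤_; _<_)
open import Data.Nat.Properties using (1+n≢0; +-suc; +-identityʳ; <-asym; ≮⇒≥; n≮0; <-≤-trans; ≤-trans; ≤-pred; ≤-refl; ≤-reflexive)
open import Data.Nat.Tactic.RingSolver using (solve-∀)
open import Data.Product using (Σ; _×_; _,_; proj₂)
open import Data.Sum using (inj₁; inj₂)
open import Function.Bundles using (_⇔_; mk⇔; Equivalence)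
open import Function.Construct.Composition using (_⇔-∘_)
open import Level using (0ℓ)
open import Relation.Binary.Bundles using (Setoid)
open import Relation.Binary.PropositionalEquality hiding ([_])
import Relation.Binary.Reasoning.Setoid as SetoidReasoning
open import Relation.Nullary using (¬_; yes; no; does)
open import Relation.Nullary.Decidable using (dec-true; dec-false; does-⇔; decidable-stable)

xorSum : (ℕ → Bool) → ℕ → Bool
xorSum f zero = false
xorSum f (suc k) = xorSum f k xor f k

xorSum-cong : ∀ {f g} → (∀ i → f i ≡ g i) → ∀ k → xorSum f k ≡ xorSum g k
xorSum-cong f≗g zero = refl
xorSum-cong f≗g (suc k) = cong₂ _xor_ (xorSum-cong f≗g k) (f≗g k)

xorSum-+ : ∀ f j k → xorSum f (j + k) ≡ xorSum f j xor xorSum (λ i → f (j + i)) k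
xorSum-+ f j zero = trans (cong (xorSum f) (+-identityʳ j)) (sym (xor-identityʳ (xorSum f j)))
xorSum-+ f j (suc k) = begin
  xorSum f (j + suc k)                                        ≡⟨ cong (xorSum f) (+-suc j k) ⟩
  xorSum f (j + k) xor f (j + k)                              ≡⟨ cong (_xor f (j + k)) (xorSum-+ f j k) ⟩
  (xorSum f j xor xorSum (λ i → f (j + i)) k) xor f (j + k)   ≡⟨ xor-assoc (xorSum f j) _ _ ⟩
  xorSum f j xor xorSum (λ i → f (j + i)) (suc k)             ∎
  where open ≡-Reasoning

module CoxeterWords {n : ℕ} (M : CoxeterMatrix n) where
  open CoxeterMatrix M
  open Coxeter M

  ~-reflexive : ∀ {u v} → u ≡ v → u ~ v
  ~-reflexive refl = ~refl

  ~-setoid : Setoid 0ℓ 0ℓ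
  ~-setoid = record
    { Carrier = Word ; _≈_ = _~_
    ; isEquivalence = record { refl = ~refl ; sym = ~sym ; trans = ~trans } }

  module ~-Reasoning = SetoidReasoning ~-setoid

  ++-congˡ : ∀ x {u v} → u ~ v → (x ++ u) ~ (x ++ v)
  ++-congˡ x (rel u v s t m≢0) =
    subst₂ _~_ (++-assoc x u _) (++-assoc x u v) (rel (x ++ u) v s t m≢0)
  ++-congˡ x ~refl = ~refl
  ++-congˡ x (~sym p) = ~sym (++-congˡ x p)
  ++-congˡ x (~trans p q) = ~trans (++-congˡ x p) (++-congˡ x q)

  ++-congʳ : ∀ y {u v} → u ~ v → (u ++ y) ~ (v ++ y)
  ++-congʳ y (rel u v s t m≢0) = subst₂ _~_
    (sym (trans (++-assoc u _ y) (cong (u ++_) (++-assoc (relator s t (m s t)) v y))))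
    (sym (++-assoc u v y))
    (rel u (v ++ y) s t m≢0)
  ++-congʳ y ~refl = ~refl
  ++-congʳ y (~sym p) = ~sym (++-congʳ y p)
  ++-congʳ y (~trans p q) = ~trans (++-congʳ y p) (++-congʳ y q)

  ++-cong : ∀ {a a′ b b′} → a ~ a′ → b ~ b′ → (a ++ b) ~ (a′ ++ b′)
  ++-cong {a′ = a′} {b = b} p q = ~trans (++-congʳ b p) (++-congˡ a′ q)

  relator-trivial : ∀ s t → m s t ≢ 0 → relator s t (m s t) ~ []
  relator-trivial s t m≢0 = subst (_~ []) (++-identityʳ _) (rel [] [] s t m≢0)

  gen-involutive : ∀ s w → (s ∷ s ∷ w) ~ w
  gen-involutive s w = ++-congʳ w (subst (λ k → relator s s k ~ []) (diag s)
    (relator-trivial s s (λ e → 1+n≢0 (trans (sym (diag s)) e))))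

  cancelʳ : ∀ u w → (u ++ reverse u ++ w) ~ w
  cancelʳ [] w = ~refl
  cancelʳ (x ∷ u) w = begin
    x ∷ (u ++ reverse (x ∷ u) ++ w)      ≡⟨ cong (λ z → x ∷ (u ++ z ++ w)) (unfold-reverse x u) ⟩
    x ∷ (u ++ (reverse u ++ [ x ]) ++ w) ≡⟨ cong (λ z → x ∷ (u ++ z)) (++-assoc (reverse u) [ x ] w) ⟩
    x ∷ (u ++ reverse u ++ x ∷ w)        ≈⟨ ++-congˡ [ x ] (cancelʳ u (x ∷ w)) ⟩
    x ∷ x ∷ w                            ≈⟨ gen-involutive x w ⟩
    w                                    ∎
    where open ~-Reasoning

  cancelˡ : ∀ u w → (reverse u ++ u ++ w) ~ w
  cancelˡ u w = subst (λ z → (reverse u ++ z ++ w) ~ w) (reverse-involutive u) (cancelʳ (reverse u) w)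

  inverseʳ : ∀ u → (u ++ reverse u) ~ []
  inverseʳ u = subst (λ z → (u ++ z) ~ []) (++-identityʳ (reverse u)) (cancelʳ u [])

  reverse-relator : ∀ s t k → reverse (relator s t k) ≡ relator t s k
  reverse-relator s t zero = refl
  reverse-relator s t (suc k) = begin
    reverse (s ∷ t ∷ relator s t k)           ≡⟨ reverse-++ (s ∷ t ∷ []) (relator s t k) ⟩
    reverse (relator s t k) ++ t ∷ s ∷ []     ≡⟨ cong (_++ t ∷ s ∷ []) (reverse-relator s t k) ⟩
    relator t s k ++ t ∷ s ∷ []               ≡⟨ relator-snoc k ⟩
    relator t s (suc k)                       ∎
    where
    open ≡-Reasoning
    relator-snoc : ∀ k → relator t s k ++ t ∷ s ∷ [] ≡ relator t s (suc k)
    relator-snoc zero = refl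
    relator-snoc (suc k) = cong (λ z → t ∷ s ∷ z) (relator-snoc k)

  reverse-cong : ∀ {u v} → u ~ v → reverse u ~ reverse v
  reverse-cong (rel u v s t m≢0) = begin
    reverse (u ++ R ++ v)                    ≡⟨ trans (reverse-++ u _) (cong (_++ reverse u) (reverse-++ R v)) ⟩
    (reverse v ++ reverse R) ++ reverse u    ≡⟨ ++-assoc (reverse v) (reverse R) (reverse u) ⟩
    reverse v ++ reverse R ++ reverse u      ≡⟨ cong (λ z → reverse v ++ z ++ reverse u) reverse-R ⟩
    reverse v ++ relator t s (m t s) ++ reverse u
      ≈⟨ rel (reverse v) (reverse u) t s (λ e → m≢0 (trans (symm s t) e)) ⟩
    reverse v ++ reverse u                   ≡⟨ reverse-++ u v ⟨
    reverse (u ++ v)                         ∎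
    where
    open ~-Reasoning
    R = relator s t (m s t)
    reverse-R : reverse R ≡ relator t s (m t s)
    reverse-R = trans (reverse-relator s t (m s t)) (cong (relator t s) (symm s t))
  reverse-cong ~refl = ~refl
  reverse-cong (~sym p) = ~sym (reverse-cong p)
  reverse-cong (~trans p q) = ~trans (reverse-cong p) (reverse-cong q)

  ≐-trans : ∀ {X Y Z : Subset} → X ≐ Y → Y ≐ Z → X ≐ Z
  ≐-trans X≐Y Y≐Z x = Y≐Z x ⇔-∘ X≐Y x

  conj : Word → Word → Word
  conj [] t = t
  conj (x ∷ u) t = conj u (x ∷ t ++ [ x ])

  conj-≡ : ∀ u t → conj u t ≡ reverse u ++ t ++ u
  conj-≡ [] t = sym (++-identityʳ t)
  conj-≡ (x ∷ u) t = begin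
    conj u (x ∷ t ++ [ x ])                ≡⟨ conj-≡ u (x ∷ t ++ [ x ]) ⟩
    reverse u ++ (x ∷ t ++ [ x ]) ++ u     ≡⟨ cong (λ z → reverse u ++ x ∷ z) (++-assoc t [ x ] u) ⟩
    reverse u ++ x ∷ t ++ x ∷ u           ≡⟨ ++-assoc (reverse u) [ x ] _ ⟨
    (reverse u ++ [ x ]) ++ t ++ x ∷ u    ≡⟨ cong (_++ t ++ x ∷ u) (unfold-reverse x u) ⟨
    reverse (x ∷ u) ++ t ++ x ∷ u         ∎
    where open ≡-Reasoning

  conj-cong : ∀ u {t t′} → t ~ t′ → conj u t ~ conj u t′
  conj-cong [] p = p
  conj-cong (x ∷ u) p = conj-cong u (++-congˡ [ x ] (++-congʳ [ x ] p))

  conj-inverse : ∀ u t → conj (reverse u) (conj u t) ~ t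
  conj-inverse u t = begin
    conj (reverse u) (conj u t)            ≡⟨ conj-≡ (reverse u) _ ⟩
    reverse (reverse u) ++ conj u t ++ reverse u
      ≡⟨ cong₂ (λ a b → a ++ b ++ reverse u) (reverse-involutive u) (conj-≡ u t) ⟩
    u ++ (reverse u ++ t ++ u) ++ reverse u
      ≡⟨ cong (u ++_) (trans (++-assoc (reverse u) _ _) (cong (reverse u ++_) (++-assoc t u (reverse u)))) ⟩
    u ++ reverse u ++ t ++ u ++ reverse u  ≈⟨ cancelʳ u _ ⟩
    t ++ u ++ reverse u                    ≈⟨ ++-congˡ t (inverseʳ u) ⟩
    t ++ []                                ≡⟨ ++-identityʳ t ⟩
    t                                      ∎
    where open ~-Reasoning

  conj-trivial : ∀ {u} t → u ~ [] → conj u t ~ t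
  conj-trivial {u} t u~[] = begin
    conj u t                  ≡⟨ conj-≡ u t ⟩
    reverse u ++ t ++ u       ≈⟨ ++-cong (reverse-cong u~[]) (++-congˡ t u~[]) ⟩
    t ++ []                   ≡⟨ ++-identityʳ t ⟩
    t                         ∎
    where open ~-Reasoning

  conj-self : ∀ u → conj (reverse u) u ~ u
  conj-self u = begin
    conj (reverse u) u                     ≡⟨ conj-≡ (reverse u) u ⟩
    reverse (reverse u) ++ u ++ reverse u  ≡⟨ cong (_++ u ++ reverse u) (reverse-involutive u) ⟩
    u ++ u ++ reverse u                    ≈⟨ ++-congˡ u (inverseʳ u) ⟩
    u ++ []                                ≡⟨ ++-identityʳ u ⟩
    u                                      ∎
    where open ~-Reasoning

  reflection : Word → Gen → Word
  reflection u s = u ++ s ∷ reverse u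

  conj-~-gen : ∀ u t x → conj u t ~ gen x ⇔ t ~ reflection u x
  conj-~-gen u t x = mk⇔
    (λ p → ~trans (~sym (conj-inverse u t)) (~trans (conj-cong (reverse u) p) (~-reflexive conj-gen)))
    (λ p → ~trans (conj-cong u p) (~trans (~-reflexive (sym (cong (conj u) conj-gen))) conj-inverse′))
    where
    conj-gen : conj (reverse u) (gen x) ≡ reflection u x
    conj-gen = trans (conj-≡ (reverse u) (gen x)) (cong (_++ x ∷ reverse u) (reverse-involutive u))
    conj-inverse′ : conj u (conj (reverse u) (gen x)) ~ gen x
    conj-inverse′ = subst (λ z → conj z (conj (reverse u) (gen x)) ~ gen x)
                            (reverse-involutive u) (conj-inverse (reverse u) (gen x))

  conj-gen-~-gen : ∀ x τ → conj [ x ] τ ~ gen x ⇔ τ ~ gen x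
  conj-gen-~-gen x τ = mk⇔
    (λ xτx~x → ~trans (Equivalence.to (conj-~-gen [ x ] τ x) xτx~x) (gen-involutive x [ x ]))
    (λ τ~x → ~trans (conj-cong [ x ] τ~x) (gen-involutive x [ x ]))

  conj-reflection : ∀ x p y → conj [ x ] (reflection p y) ≡ reflection (x ∷ p) y
  conj-reflection x p y = cong (x ∷_) (begin
    (p ++ y ∷ reverse p) ++ [ x ]   ≡⟨ ++-assoc p (y ∷ reverse p) [ x ] ⟩
    p ++ y ∷ (reverse p ++ [ x ])   ≡⟨ cong (λ z → p ++ y ∷ z) (unfold-reverse x p) ⟨
    p ++ y ∷ reverse (x ∷ p)        ∎)
    where open ≡-Reasoning

  reverse-reflection : ∀ p x → reverse (reflection p x) ≡ reflection p x
  reverse-reflection p x = begin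
    reverse (p ++ x ∷ reverse p)               ≡⟨ reverse-++ p (x ∷ reverse p) ⟩
    reverse (x ∷ reverse p) ++ reverse p       ≡⟨ cong (_++ reverse p) (unfold-reverse x (reverse p)) ⟩
    (reverse (reverse p) ++ [ x ]) ++ reverse p ≡⟨ cong (λ z → (z ++ [ x ]) ++ reverse p) (reverse-involutive p) ⟩
    (p ++ [ x ]) ++ reverse p                  ≡⟨ ++-assoc p [ x ] (reverse p) ⟩
    p ++ x ∷ reverse p                         ∎
    where open ≡-Reasoning

  reverse-T : ∀ r → InT r → reverse r ~ r
  reverse-T r (p , x , r~t) = ~trans (reverse-cong r~t) (~trans (~-reflexive (reverse-reflection p x)) (~sym r~t))

  T-involutive : ∀ r → InT r → (r ++ r) ~ []
  T-involutive r r∈T = ~trans (++-congˡ r (~sym (reverse-T r r∈T))) (inverseʳ r)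

  gen-conjugate-++ : ∀ s {u v w} → (u ++ v) ~ w → (reverse v ++ (reverse u ++ s ∷ u) ++ v) ~ (reverse w ++ s ∷ w)
  gen-conjugate-++ s {u} {v} {w} uv~w = begin
    reverse v ++ (reverse u ++ s ∷ u) ++ v   ≡⟨ cong (reverse v ++_) (++-assoc (reverse u) (s ∷ u) v) ⟩
    reverse v ++ reverse u ++ s ∷ u ++ v     ≡⟨ ++-assoc (reverse v) (reverse u) _ ⟨
    (reverse v ++ reverse u) ++ s ∷ u ++ v   ≡⟨ cong (_++ s ∷ u ++ v) (reverse-++ u v) ⟨
    reverse (u ++ v) ++ s ∷ u ++ v           ≈⟨ ++-cong (reverse-cong uv~w) (++-congˡ [ s ] uv~w) ⟩
    reverse w ++ s ∷ w                       ∎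
    where open ~-Reasoning

  gen-conjugate-∷ : ∀ s w → (reverse (s ∷ w) ++ s ∷ s ∷ w) ~ (reverse w ++ s ∷ w)
  gen-conjugate-∷ s w = begin
    reverse (s ∷ w) ++ s ∷ s ∷ w       ≡⟨ cong (_++ s ∷ s ∷ w) (unfold-reverse s w) ⟩
    (reverse w ++ [ s ]) ++ s ∷ s ∷ w  ≡⟨ ++-assoc (reverse w) [ s ] _ ⟩
    reverse w ++ s ∷ s ∷ s ∷ w         ≈⟨ ++-congˡ (reverse w) (gen-involutive s (s ∷ w)) ⟩
    reverse w ++ s ∷ w                 ∎
    where open ~-Reasoning

  alternating : Gen → Gen → ℕ → Word
  alternating a b zero = []
  alternating a b (suc k) = a ∷ alternating b a k

  alternating-last : Gen → Gen → ℕ → Gen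
  alternating-last a b zero = a
  alternating-last a b (suc k) = alternating-last b a k

  alternating-snoc : ∀ a b k → alternating a b (suc k) ≡ alternating a b k ++ [ alternating-last a b k ]
  alternating-snoc a b zero = refl
  alternating-snoc a b (suc k) = cong (a ∷_) (alternating-snoc b a k)

  alternating-last-even : ∀ a b k → alternating-last a b (k + k) ≡ a
  alternating-last-even a b zero = refl
  alternating-last-even a b (suc k) = trans (cong (alternating-last b a) (+-suc k k)) (alternating-last-even a b k)

  relator-alternating : ∀ a b k → relator a b k ≡ alternating a b (k + k)
  relator-alternating a b zero = refl
  relator-alternating a b (suc k) =
    trans (cong (λ z → a ∷ b ∷ z) (relator-alternating a b k)) (cong (λ i → a ∷ alternating b a i) (sym (+-suc k k)))

  alternating-+ : ∀ a b k j → alternating a b ((k + k) + j) ≡ relator a b k ++ alternating a b j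
  alternating-+ a b zero j = refl
  alternating-+ a b (suc k) j =
    trans (cong (λ i → alternating a b (suc i + j)) (+-suc k k)) (cong (λ z → a ∷ b ∷ z) (alternating-+ a b k j))

  alternating-reflection : ∀ a b k →
    reflection (alternating a b k) (alternating-last a b k) ≡ alternating a b (suc (k + k))
  alternating-reflection a b zero = refl
  alternating-reflection a b (suc k) = begin
    a ∷ (alt ++ c ∷ reverse (a ∷ alt))         ≡⟨ cong (λ z → a ∷ (alt ++ c ∷ z)) (unfold-reverse a alt) ⟩
    a ∷ (alt ++ c ∷ (reverse alt ++ [ a ]))    ≡⟨ cong (a ∷_) (++-assoc alt (c ∷ reverse alt) [ a ]) ⟨
    a ∷ (reflection alt c ++ [ a ])            ≡⟨ cong (λ z → a ∷ (z ++ [ a ])) (alternating-reflection b a k) ⟩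
    a ∷ (alternating b a (suc (k + k)) ++ [ a ])
      ≡⟨ cong (λ z → a ∷ (alternating b a (suc (k + k)) ++ [ z ])) (alternating-last-even a b k) ⟨
    a ∷ (alternating b a (suc (k + k)) ++ [ alternating-last b a (suc (k + k)) ])
      ≡⟨ cong (a ∷_) (alternating-snoc b a (suc (k + k))) ⟨
    a ∷ alternating b a (suc (suc (k + k)))     ≡⟨ cong (λ i → a ∷ alternating b a (suc i)) (+-suc k k) ⟨
    a ∷ alternating b a (suc (k + suc k))      ∎
    where
    open ≡-Reasoning
    alt = alternating b a k
    c = alternating-last b a k

module ReflectionCocycle (em : ExcludedMiddle 0ℓ) {n : ℕ} (M : CoxeterMatrix n) where
  open CoxeterMatrix M using (m)
  open Coxeter M
  open CoxeterWords M

  -- _~_ is not decidable here, so propositions get their truth values from excluded middle.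
  ⟦_⟧ : Set → Bool
  ⟦ P ⟧ = does (em {P})

  ⟦⟧-cong : ∀ {P Q} → P ⇔ Q → ⟦ P ⟧ ≡ ⟦ Q ⟧
  ⟦⟧-cong P⇔Q = does-⇔ P⇔Q em em

  ⟦⟧-true : ∀ {P} → P → ⟦ P ⟧ ≡ true
  ⟦⟧-true = dec-true em

  ⟦⟧-false : ∀ {P} → ¬ P → ⟦ P ⟧ ≡ false
  ⟦⟧-false = dec-false em

  parity : Word → Word → Bool
  parity τ [] = false
  parity τ (x ∷ w) = ⟦ τ ~ gen x ⟧ xor parity (conj [ x ] τ) w

  parity-congˡ : ∀ {τ τ′} w → τ ~ τ′ → parity τ w ≡ parity τ′ w
  parity-congˡ [] p = refl
  parity-congˡ (x ∷ w) p = cong₂ _xor_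
    (⟦⟧-cong (mk⇔ (~trans (~sym p)) (~trans p)))
    (parity-congˡ w (conj-cong [ x ] p))

  parity-++ : ∀ τ u v → parity τ (u ++ v) ≡ parity τ u xor parity (conj u τ) v
  parity-++ τ [] v = refl
  parity-++ τ (x ∷ u) v = trans (cong (⟦ τ ~ gen x ⟧ xor_) (parity-++ (conj [ x ] τ) u v))
                                (sym (xor-assoc ⟦ τ ~ gen x ⟧ _ _))

  parity-snoc : ∀ τ u x → parity τ (u ++ [ x ]) ≡ parity τ u xor ⟦ τ ~ reflection u x ⟧
  parity-snoc τ u x = begin
    parity τ (u ++ [ x ])                                 ≡⟨ parity-++ τ u [ x ] ⟩
    parity τ u xor (⟦ conj u τ ~ gen x ⟧ xor false)       ≡⟨ cong (parity τ u xor_) (xor-identityʳ _) ⟩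
    parity τ u xor ⟦ conj u τ ~ gen x ⟧                   ≡⟨ cong (parity τ u xor_) (⟦⟧-cong (conj-~-gen u τ x)) ⟩
    parity τ u xor ⟦ τ ~ reflection u x ⟧                 ∎
    where open ≡-Reasoning

  parity-alternating : ∀ τ a b k →
    parity τ (alternating a b k) ≡ xorSum (λ i → ⟦ τ ~ alternating a b (suc (i + i)) ⟧) k
  parity-alternating τ a b zero = refl
  parity-alternating τ a b (suc k) = begin
    parity τ (alternating a b (suc k))
      ≡⟨ cong (parity τ) (alternating-snoc a b k) ⟩
    parity τ (alternating a b k ++ [ alternating-last a b k ])
      ≡⟨ parity-snoc τ (alternating a b k) (alternating-last a b k) ⟩
    parity τ (alternating a b k) xor ⟦ τ ~ reflection (alternating a b k) (alternating-last a b k) ⟧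
      ≡⟨ cong₂ (λ p r → p xor ⟦ τ ~ r ⟧) (parity-alternating τ a b k) (alternating-reflection a b k) ⟩
    xorSum (λ i → ⟦ τ ~ alternating a b (suc (i + i)) ⟧) (suc k) ∎
    where open ≡-Reasoning

  -- The crossings of the alternating word a b a ⋯ of length 2k are the words a(ba)ⁱ; when
  -- (ab)ᵏ = 1 they repeat with period k, so each one is crossed an even number of times.
  parity-relator : ∀ τ a b k → relator a b k ~ [] → parity τ (relator a b k) ≡ false
  parity-relator τ a b k R~[] = begin
    parity τ (relator a b k)                      ≡⟨ cong (parity τ) (relator-alternating a b k) ⟩
    parity τ (alternating a b (k + k))            ≡⟨ parity-alternating τ a b (k + k) ⟩
    xorSum crossing (k + k)                        ≡⟨ xorSum-+ crossing k k ⟩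
    xorSum crossing k xor xorSum (λ i → crossing (k + i)) k
      ≡⟨ cong (xorSum crossing k xor_) (xorSum-cong periodic k) ⟩
    xorSum crossing k xor xorSum crossing k       ≡⟨ xor-same (xorSum crossing k) ⟩
    false                                          ∎
    where
    open ≡-Reasoning
    crossing : ℕ → Bool
    crossing i = ⟦ τ ~ alternating a b (suc (i + i)) ⟧
    shift : ∀ i → alternating a b (suc ((k + i) + (k + i))) ~ alternating a b (suc (i + i))
    shift i = ~trans
      (~-reflexive (trans (cong (alternating a b) (index-shift k i)) (alternating-+ a b k (suc (i + i)))))
      (++-congʳ (alternating a b (suc (i + i))) R~[])
      where
      index-shift : ∀ k i → suc ((k + i) + (k + i)) ≡ (k + k) + suc (i + i)
      index-shift = solve-∀
    periodic : ∀ i → crossing (k + i) ≡ crossing i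
    periodic i = ⟦⟧-cong (mk⇔ (λ p → ~trans p (shift i)) (λ p → ~trans p (~sym (shift i))))

  parity-cong : ∀ {u v} → u ~ v → ∀ τ → parity τ u ≡ parity τ v
  parity-cong (rel u v a b m≢0) τ = begin
    parity τ (u ++ R ++ v)                          ≡⟨ parity-++ τ u (R ++ v) ⟩
    parity τ u xor parity c (R ++ v)                ≡⟨ cong (parity τ u xor_) (parity-++ c R v) ⟩
    parity τ u xor (parity c R xor parity (conj R c) v)
      ≡⟨ cong (λ z → parity τ u xor (z xor parity (conj R c) v)) (parity-relator c a b (m a b) R~[]) ⟩
    parity τ u xor parity (conj R c) v              ≡⟨ cong (parity τ u xor_) (parity-congˡ v (conj-trivial c R~[])) ⟩
    parity τ u xor parity c v                       ≡⟨ parity-++ τ u v ⟨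
    parity τ (u ++ v)                               ∎
    where
    open ≡-Reasoning
    R = relator a b (m a b)
    c = conj u τ
    R~[] : R ~ []
    R~[] = relator-trivial a b m≢0
  parity-cong ~refl τ = refl
  parity-cong (~sym p) τ = sym (parity-cong p τ)
  parity-cong (~trans p q) τ = trans (parity-cong p τ) (parity-cong q τ)

  parity-true⇒crossing : ∀ τ w → parity τ w ≡ true →
    Σ Word λ p → Σ Gen λ x → Σ Word λ q → (w ≡ p ++ x ∷ q) × (τ ~ reflection p x)
  parity-true⇒crossing τ [] ()
  parity-true⇒crossing τ (x ∷ w) odd with em {τ ~ gen x}
  ... | yes τ~x = [] , x , w , refl , τ~x
  ... | no _ with parity-true⇒crossing (conj [ x ] τ) w odd
  ...   | p , y , q , refl , xτx~t =
    x ∷ p , y , q , refl ,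
    ~trans (~sym (conj-inverse [ x ] τ)) (~trans (conj-cong [ x ] xτx~t) (~-reflexive (conj-reflection x p y)))

  parity-reverse : ∀ u τ → parity (conj u τ) (reverse u) ≡ parity τ u
  parity-reverse [] τ = refl
  parity-reverse (x ∷ u) τ = begin
    parity C (reverse (x ∷ u))                              ≡⟨ cong (parity C) (unfold-reverse x u) ⟩
    parity C (reverse u ++ [ x ])                           ≡⟨ parity-snoc C (reverse u) x ⟩
    parity C (reverse u) xor ⟦ C ~ reflection (reverse u) x ⟧
      ≡⟨ cong₂ _xor_ (parity-reverse u (conj [ x ] τ)) (⟦⟧-cong crossing) ⟩
    parity (conj [ x ] τ) u xor ⟦ τ ~ gen x ⟧               ≡⟨ xor-comm (parity (conj [ x ] τ) u) _ ⟩
    parity τ (x ∷ u)                                        ∎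
    where
    open ≡-Reasoning
    C = conj u (conj [ x ] τ)
    crossing : C ~ reflection (reverse u) x ⇔ τ ~ gen x
    crossing = mk⇔
      (λ C~t → Equivalence.to (conj-gen-~-gen x τ)
                 (~trans (~sym (conj-inverse u _)) (Equivalence.from (conj-~-gen (reverse u) C x) C~t)))
      (λ τ~x → Equivalence.to (conj-~-gen (reverse u) C x)
                 (~trans (conj-inverse u _) (Equivalence.from (conj-gen-~-gen x τ) τ~x)))

  parity-reflection : ∀ τ p x → τ ~ reflection p x → parity τ (reflection p x) ≡ true
  parity-reflection τ p x τ~t = begin
    parity τ (p ++ x ∷ reverse p)                           ≡⟨ parity-++ τ p (x ∷ reverse p) ⟩
    parity τ p xor (⟦ c ~ gen x ⟧ xor parity (conj [ x ] c) (reverse p))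
      ≡⟨ cong₂ (λ b q → parity τ p xor (b xor q)) (⟦⟧-true c~x) (parity-congˡ (reverse p) xcx~c) ⟩
    parity τ p xor (true xor parity c (reverse p))
      ≡⟨ cong (λ q → parity τ p xor (true xor q)) (parity-reverse p τ) ⟩
    parity τ p xor (true xor parity τ p)                    ≡⟨ xor-true-xor (parity τ p) ⟩
    true                                                    ∎
    where
    open ≡-Reasoning
    xor-true-xor : ∀ b → b xor (true xor b) ≡ true
    xor-true-xor false = refl
    xor-true-xor true = refl
    c = conj p τ
    c~x : c ~ gen x
    c~x = Equivalence.from (conj-~-gen p τ x) τ~t
    xcx~c : conj [ x ] c ~ c
    xcx~c = ~trans (Equivalence.from (conj-gen-~-gen x c) c~x) (~sym c~x)

  parity-self : ∀ r → InT r → parity r (reverse r) ≡ true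
  parity-self r (p , x , r~t) = begin
    parity r (reverse r)                ≡⟨ parity-cong (reverse-cong r~t) r ⟩
    parity r (reverse (reflection p x)) ≡⟨ cong (parity r) (reverse-reflection p x) ⟩
    parity r (reflection p x)           ≡⟨ parity-reflection r p x r~t ⟩
    true                                ∎
    where open ≡-Reasoning

  parity-gen-∷ : ∀ r s u → ¬ r ~ (reverse u ++ s ∷ u) → parity r (reverse (s ∷ u)) ≡ parity r (reverse u)
  parity-gen-∷ r s u r≁s^u = begin
    parity r (reverse (s ∷ u))                               ≡⟨ cong (parity r) (unfold-reverse s u) ⟩
    parity r (reverse u ++ [ s ])                            ≡⟨ parity-snoc r (reverse u) s ⟩
    parity r (reverse u) xor ⟦ r ~ reflection (reverse u) s ⟧ ≡⟨ cong (parity r (reverse u) xor_) (⟦⟧-false r≁t) ⟩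
    parity r (reverse u) xor false                           ≡⟨ xor-identityʳ _ ⟩
    parity r (reverse u)                                     ∎
    where
    open ≡-Reasoning
    r≁t : ¬ r ~ reflection (reverse u) s
    r≁t r~t = r≁s^u (subst (λ z → r ~ (reverse u ++ s ∷ z)) (reverse-involutive u) r~t)

  ℓ<-respˡ : ∀ {u u′ v} → u ~ u′ → u ℓ< v → u′ ℓ< v
  ℓ<-respˡ p (u₀ , u₀~u , shorter) = u₀ , ~trans u₀~u p , shorter

  ℓ<-respʳ : ∀ {u v v′} → v ~ v′ → u ℓ< v → u ℓ< v′
  ℓ<-respʳ p (u₀ , u₀~u , shorter) = u₀ , u₀~u , λ v₀ v₀~v′ → shorter v₀ (~trans v₀~v′ (~sym p))

  ℓ<-asym : ∀ {u v} → u ℓ< v → v ℓ< u → ⊥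
  ℓ<-asym (u₀ , u₀~u , shorter) (v₀ , v₀~v , shorter′) = <-asym (shorter v₀ v₀~v) (shorter′ u₀ u₀~u)

  ReducedExpression : Word → Set
  ReducedExpression w = Σ Word λ w₀ → w₀ ~ w × (∀ w′ → w′ ~ w → length w₀ ≤ length w′)

  reducedExpression : ∀ w → ReducedExpression w
  reducedExpression w = descend (length w) w ≤-refl ~refl
    where
    descend : ∀ k w₀ → length w₀ ≤ k → w₀ ~ w → ReducedExpression w
    descend k w₀ w₀≤k w₀~w with em {Σ Word λ w′ → w′ ~ w × length w′ < length w₀}
    ... | no ¬shorter = w₀ , w₀~w , λ w′ w′~w → ≮⇒≥ (λ lt → ¬shorter (w′ , w′~w , lt))
    descend zero    w₀ w₀≤k w₀~w | yes (w′ , _ , lt) = ⊥-elim (n≮0 (<-≤-trans lt w₀≤k))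
    descend (suc k) w₀ w₀≤k w₀~w | yes (w′ , w′~w , lt) = descend k w′ (≤-pred (≤-trans lt w₀≤k)) w′~w

  reverse-split : ∀ {w} p (x : Gen) q → reverse w ≡ p ++ x ∷ q → w ≡ reverse q ++ x ∷ reverse p
  reverse-split {w} p x q eq = begin
    w                               ≡⟨ reverse-involutive w ⟨
    reverse (reverse w)             ≡⟨ cong reverse eq ⟩
    reverse (p ++ x ∷ q)            ≡⟨ reverse-++ p (x ∷ q) ⟩
    reverse (x ∷ q) ++ reverse p    ≡⟨ cong (_++ reverse p) (unfold-reverse x q) ⟩
    (reverse q ++ [ x ]) ++ reverse p ≡⟨ ++-assoc (reverse q) [ x ] (reverse p) ⟩
    reverse q ++ x ∷ reverse p      ∎
    where open ≡-Reasoning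

  deletion : ∀ {r} p x q → r ~ reflection p x → ((reverse q ++ x ∷ reverse p) ++ r) ~ (reverse q ++ reverse p)
  deletion {r} p x q r~pxp⁻¹ = begin
    (reverse q ++ x ∷ reverse p) ++ r                    ≈⟨ ++-congˡ (reverse q ++ x ∷ reverse p) r~pxp⁻¹ ⟩
    (reverse q ++ x ∷ reverse p) ++ p ++ x ∷ reverse p   ≡⟨ ++-assoc (reverse q) (x ∷ reverse p) _ ⟩
    reverse q ++ x ∷ (reverse p ++ p ++ x ∷ reverse p)
      ≈⟨ ++-congˡ (reverse q) (++-congˡ [ x ] (cancelˡ p (x ∷ reverse p))) ⟩
    reverse q ++ x ∷ x ∷ reverse p                       ≈⟨ ++-congˡ (reverse q) (gen-involutive x (reverse p)) ⟩
    reverse q ++ reverse p                               ∎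
    where open ~-Reasoning

  parity⇒descent : ∀ r w → parity r (reverse w) ≡ true → (w · r) ℓ< w
  parity⇒descent r w odd with reducedExpression w
  ... | w₀ , w₀~w , minimal
    with parity-true⇒crossing r (reverse w₀) (trans (parity-cong (reverse-cong w₀~w) r) odd)
  ... | p , x , q , eq , r~pxp⁻¹ =
    reverse q ++ reverse p , deleted~wr , λ v v~w → <-≤-trans shorter (minimal v v~w)
    where
    w₀≡ : w₀ ≡ reverse q ++ x ∷ reverse p
    w₀≡ = reverse-split p x q eq
    deleted~wr : (reverse q ++ reverse p) ~ (w ++ r)
    deleted~wr = ~trans (~sym (deletion p x q r~pxp⁻¹)) (++-congʳ r (~trans (~-reflexive (sym w₀≡)) w₀~w))
    shorter : length (reverse q ++ reverse p) < length w₀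
    shorter = subst (λ z → length (reverse q ++ reverse p) < length z) (sym w₀≡)
                    (≤-reflexive (sym (length-++-sucʳ (reverse q) x (reverse p))))

  descent⇒parity : ∀ r w → InT r → (w · r) ℓ< w → parity r (reverse w) ≡ true
  descent⇒parity r w r∈T wr<w with parity r (reverse w) in even
  ... | true = refl
  ... | false = ⊥-elim (ℓ<-asym wr<w (ℓ<-respˡ wrr~w (parity⇒descent r (w ++ r) odd)))
    where
    wrr~w : ((w ++ r) ++ r) ~ w
    wrr~w = ~trans (~-reflexive (++-assoc w r r))
                   (~trans (++-congˡ w (T-involutive r r∈T)) (~-reflexive (++-identityʳ w)))
    odd : parity r (reverse (w ++ r)) ≡ true
    odd = begin
      parity r (reverse (w ++ r))                    ≡⟨ cong (parity r) (reverse-++ w r) ⟩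
      parity r (reverse r ++ reverse w)              ≡⟨ parity-++ r (reverse r) (reverse w) ⟩
      parity r (reverse r) xor parity (conj (reverse r) r) (reverse w)
        ≡⟨ cong₂ _xor_ (parity-self r r∈T) (parity-congˡ (reverse w) (conj-self r)) ⟩
      true xor parity r (reverse w)                  ≡⟨ cong (true xor_) even ⟩
      true                                           ∎
      where open ≡-Reasoning

module DescentSets (em : ExcludedMiddle 0ℓ) {n : ℕ} (M : CoxeterMatrix n)
                   (A : Coxeter.Subset M) (A-resp : Coxeter.RespectsW M A) (A⊆T : ∀ t → A t → Coxeter.InT M t) where
  open Coxeter M
  open CoxeterWords M
  open ReflectionCocycle em M

  D-cong : ∀ {w w′} → w ~ w′ → D A w ≐ D A w′
  D-cong w~w′ r = mk⇔
    (λ (r∈A , wr<w) → r∈A , ℓ<-respʳ w~w′ (ℓ<-respˡ (++-congʳ r w~w′) wr<w))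
    (λ (r∈A , wr<w) → r∈A , ℓ<-respʳ (~sym w~w′) (ℓ<-respˡ (++-congʳ r (~sym w~w′)) wr<w))

  D-gen-invariant : ∀ s u → ¬ A ((u ⁻¹) · (gen s · u)) → D A (gen s · u) ≐ D A u
  D-gen-invariant s u s^u∉A r = mk⇔
    (λ (r∈A , sur<su) → r∈A , parity⇒descent r u
        (trans (sym (same r∈A)) (descent⇒parity r (s ∷ u) (A⊆T r r∈A) sur<su)))
    (λ (r∈A , ur<u) → r∈A , parity⇒descent r (s ∷ u)
        (trans (same r∈A) (descent⇒parity r u (A⊆T r r∈A) ur<u)))
    where
    same : A r → parity r (reverse (s ∷ u)) ≡ parity r (reverse u)
    same r∈A = parity-gen-∷ r s u (λ r~s^u → s^u∉A (A-resp r~s^u r∈A))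

  smile-gen⇔ : ∀ s u → Smile A u (gen s · u) ⇔ (¬ A ((u ⁻¹) · (gen s · u)))
  smile-gen⇔ s u = mk⇔ proj₂ (λ s^u∉A → (s , ++-congˡ [ s ] (inverseʳ u)) , s^u∉A)

  module _ (nice : Nice A) {I J : Subset} {w : Word} {s : Gen} (w⌣sw : Smile A w (gen s · w)) where

    ψ-into : ∀ {u v p q} → InDIJ A I J w u v → Psi A s u v p q → InDIJ A I J (gen s · w) p q
    ψ-into (Iu , Jv , uv~w) (inj₁ (u⌣su , p~su , q~v)) =
      ≐-trans (D-cong p~su) (≐-trans (D-gen-invariant s _ (proj₂ u⌣su)) Iu) ,
      ≐-trans (D-cong q~v) Jv ,
      ~trans (++-cong p~su q~v) (++-congˡ [ s ] uv~w)
    ψ-into {u} {v} {p} {q} (Iu , Jv , uv~w) (inj₂ (¬u⌣su , p~u , q~s^uv)) =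
      ≐-trans (D-cong p~u) Iu ,
      ≐-trans (D-cong q~rv) (≐-trans (nice r v r∈A r^v∉A) Jv) ,
      ~trans (++-cong p~u q~s^uv) (~trans (cancelʳ u (s ∷ u ++ v)) (++-congˡ [ s ] uv~w))
      where
      r = reverse u ++ s ∷ u
      r∈A : A r
      r∈A = decidable-stable em (λ r∉A → ¬u⌣su (Equivalence.from (smile-gen⇔ s u) r∉A))
      r^v∉A : ¬ A ((v ⁻¹) · (r · v))
      r^v∉A r^v∈A = proj₂ w⌣sw (A-resp (gen-conjugate-++ s {u} {v} uv~w) r^v∈A)
      q~rv : q ~ (r · v)
      q~rv = ~trans q~s^uv (~-reflexive (sym (++-assoc (reverse u) (s ∷ u) v)))

    ψ-onto : ∀ {p q} → InDIJ A I J (gen s · w) p q →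
             Σ Word λ u → Σ Word λ v → InDIJ A I J w u v × Psi A s u v p q
    ψ-onto {p} {q} (Ip , Jq , pq~sw) with em {A ((p ⁻¹) · (gen s · p))}
    ... | no s^p∉A =
      s ∷ p , q ,
      (≐-trans (D-gen-invariant s p s^p∉A) Ip , Jq , ~trans (++-congˡ [ s ] pq~sw) (gen-involutive s w)) ,
      inj₁ (Equivalence.from (smile-gen⇔ s (s ∷ p)) (λ a → s^p∉A (A-resp (gen-conjugate-∷ s p) a)) ,
            ~sym (gen-involutive s p) , ~refl)
    ... | yes r∈A =
      p , r ++ q ,
      (Ip , ≐-trans (nice r q r∈A r^q∉A) Jq , prq~w) ,
      inj₂ ((λ p⌣sp → proj₂ p⌣sp r∈A) , ~refl , q~rrq)
      where
      r = reverse p ++ s ∷ p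
      r^q∉A : ¬ A ((q ⁻¹) · (r · q))
      r^q∉A r^q∈A = proj₂ w⌣sw (A-resp (~trans (gen-conjugate-++ s {p} {q} pq~sw) (gen-conjugate-∷ s w)) r^q∈A)
      prq~w : (p ++ r ++ q) ~ w
      prq~w = begin
        p ++ (reverse p ++ s ∷ p) ++ q   ≡⟨ cong (p ++_) (++-assoc (reverse p) (s ∷ p) q) ⟩
        p ++ reverse p ++ s ∷ p ++ q     ≈⟨ cancelʳ p (s ∷ p ++ q) ⟩
        s ∷ p ++ q                       ≈⟨ ++-congˡ [ s ] pq~sw ⟩
        s ∷ s ∷ w                        ≈⟨ gen-involutive s w ⟩
        w                                ∎
        where open ~-Reasoning
      q~rrq : q ~ (reverse p ++ s ∷ p ++ r ++ q)
      q~rrq = begin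
        q                               ≈⟨ ++-congʳ q (T-involutive r (A⊆T r r∈A)) ⟨
        (r ++ r) ++ q                   ≡⟨ ++-assoc r r q ⟩
        r ++ r ++ q                     ≡⟨ ++-assoc (reverse p) (s ∷ p) (r ++ q) ⟩
        reverse p ++ s ∷ p ++ r ++ q    ∎
        where open ~-Reasoning

proposition1p13 : ExcludedMiddle Level.zero → (n : ℕ) → (M : CoxeterMatrix n) → let open Coxeter M in
    (A : Subset) → RespectsW A → (∀ t → A t → InT t) → Nice A
  → (I J : Subset) → Admissible A I → Admissible A J
  → (w : Word) → (s : Gen) → Smile A w (gen s · w)
  → ∀ p q → (Σ Word λ u → Σ Word λ v → InDIJ A I J w u v × Psi A s u v p q)
      ⇔ InDIJ A I J (gen s · w) p q
proposition1p13 em n M A A-resp A⊆T nice I J _ _ w s w⌣sw p q =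
  mk⇔ (λ (u , v , uv∈D , uv↦pq) → ψ-into nice w⌣sw uv∈D uv↦pq) (ψ-onto nice w⌣sw)
  where open DescentSets em M A A-resp A⊆T
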